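{- Let $G=(V,E)$ be a fixed connected undirected graph on $n$ vertices and let $\gamma=\min_{S\subset V,\,0<|S|\le n/2}\{\nu(B(S))/|S|\}$. Then optimal rumor spreading in $G$ in the mobile telephone model terminates in $O((1/\gamma)\log n)$ rounds.
   Context: $B(S)$ is the bipartite graph with bipartition $(S,V\setminus S)$ and edge set $\{(u,v)\in E: u\in S,v\in V\setminus S\}$; $\nu(H)$ is the maximum matching size of $H$. Mobile telephone model: synchronous rounds; each node may send a connection proposal to at most one neighbor; a node that sends a proposal cannot receive one; a node that sent no proposal and received at least one may accept at most one; connected pairs exchange unbounded information. Rumor spreading: a single source starts with a rumor; solved once all nodes know it, information passing only across connections. -}

module Defs where

open import Data.Nat using (ℕ; zero; suc; _+_; _*_; _≤_; _<_; NonZero)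
open import Data.Bool using (Bool; true; false)
open import Data.Fin using (Fin)
open import Data.Fin.Subset using (Subset; _∈_; _∉_; ∣_∣)
open import Data.Maybe using (Maybe; just; nothing)
open import Data.Vec using (Vec; []; _∷_)
open import Data.Product using (Σ; ∃; ∃-syntax; _×_; _,_)
open import Data.Sum using (_⊎_)
open import Function.Definitions using (Injective)
open import Relation.Binary.PropositionalEquality using (_≡_)

record Graph (n : ℕ) : Set where
  field
    Adj   : Fin n → Fin n → Bool
    sym   : ∀ u v → Adj u v ≡ Adj v u
    irref : ∀ u → Adj u u ≡ false
open Graph public

data Reach {n : ℕ} (G : Graph n) : Fin n → Fin n → Set where
  here : ∀ {u} → Reach G u u
  step : ∀ {u v w} → Adj G u v ≡ true → Reach G v w → Reach G u w

Connected : {n : ℕ} → Graph n → Set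
Connected {n} G = ∀ (u v : Fin n) → Reach G u v

-- A matching of size k in the bipartite graph B(S), whose edges are
-- the edges of G with one endpoint in S and the other in V ∖ S:
-- k edges (left i , right i), with all 2k endpoints distinct.
record MatchingB {n : ℕ} (G : Graph n) (S : Subset n) (k : ℕ) : Set where
  field
    left     : Fin k → Fin n
    right    : Fin k → Fin n
    leftIn   : ∀ i → left i ∈ S
    rightOut : ∀ i → right i ∉ S
    isEdge   : ∀ i → Adj G (left i) (right i) ≡ true
    injL     : Injective _≡_ _≡_ left
    injR     : Injective _≡_ _≡_ right

IsNu : {n : ℕ} → Graph n → Subset n → ℕ → Set
IsNu G S k = MatchingB G S k × (∀ j → MatchingB G S j → j ≤ k)

-- γ = p / q  where γ = min { ν(B(S)) / |S| : S ⊆ V, 0 < |S| ≤ n/2 }.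
-- (The minimum is attained by some S, and is a lower bound for all S.)
IsGamma : {n : ℕ} → Graph n → ℕ → ℕ → Set
IsGamma {n} G p q =
  NonZero q
  × (∃[ S ] (0 < ∣ S ∣ × 2 * ∣ S ∣ ≤ n
             × ∃[ k ] (IsNu G S k × k * q ≡ p * ∣ S ∣)))
  × (∀ S → 0 < ∣ S ∣ → 2 * ∣ S ∣ ≤ n → ∀ k → IsNu G S k → p * ∣ S ∣ ≤ k * q)

-- One round of the mobile telephone model.
-- prop u = just v : u sends a connection proposal to its neighbour v.
-- acc v = just u  : v (which sent no proposal) accepts the proposal of u.
record Round {n : ℕ} (G : Graph n) : Set where
  field
    prop     : Fin n → Maybe (Fin n)
    propAdj  : ∀ u v → prop u ≡ just v → Adj G u v ≡ true
    acc      : Fin n → Maybe (Fin n)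
    accValid : ∀ v u → acc v ≡ just u → prop v ≡ nothing × prop u ≡ just v
open Round public

Conn : {n : ℕ} {G : Graph n} → Round G → Fin n → Fin n → Set
Conn r u v = acc r v ≡ just u

stepInformed : {n : ℕ} {G : Graph n} → Round G → (Fin n → Set) → (Fin n → Set)
stepInformed r I w = I w ⊎ (∃[ u ] (Conn r u w × I u)) ⊎ (∃[ v ] (Conn r w v × I v))

run : {n : ℕ} {G : Graph n} {T : ℕ} → (Fin n → Set) → Vec (Round G) T → (Fin n → Set)
run I []       = I
run I (r ∷ rs) = run (stepInformed r I) rs

SolvesIn : {n : ℕ} → (G : Graph n) → Fin n → ℕ → Set
SolvesIn {n} G src T =
  Σ (Vec (Round G) T) λ rs → ∀ (w : Fin n) → run (λ x → x ≡ src) rs w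

-- While at most half of the nodes are informed, a maximum matching of B(I) between
-- the informed set I and the rest is one round of the model that informs ν(B(I)) ≥ γ|I| new
-- nodes, so after B ≈ 1/γ rounds the informed set has doubled; once more than half are
-- informed, matching B(∁I) likewise halves the uninformed set every B rounds. Each phase
-- takes at most ⌈log₂ n⌉ blocks of B rounds, hence 2 B ⌈log₂ n⌉ ≤ 4 ⌈log₂ n⌉ / γ rounds in
-- all; γ ≤ 1 because a matching of B(S) has at most |S| edges.
module Submission where

open import Defs
open import Data.Bool using (true)
import Data.Bool.Properties as Bool
open import Data.Empty using (⊥-elim)
open import Data.Fin using (Fin; zero; suc)
open import Data.Fin.Properties using (any?; all?; suc-injective; injective⇒≤)
  renaming (_≟_ to _≟ᶠ_)
open import Data.Fin.Subset using (Subset; _∈_; _∉_; ∣_∣; ∁; ⊥; ⊤; ⁅_⁆; _∪_; _⊆_; Nonempty)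
open import Data.Fin.Subset.Properties
open import Data.Maybe using (Maybe; just; nothing)
open import Data.Nat using (ℕ; zero; suc; _+_; _*_; _^_; _≤_; _<_; _≟_; _<?_; z≤n; s≤s;
  NonZero; >-nonZero; >-nonZero⁻¹; ⌈_/2⌉; _/_)
open import Data.Nat.DivMod using (m≡m%n+[m/n]*n; m%n<n; m/n*n≤m)
open import Data.Nat.Logarithm using (⌈log₂_⌉)
open import Data.Nat.Logarithm.Core using (⌈log2⌉)
open import Data.Nat.Properties hiding (suc-injective)
open import Data.Nat.Tactic.RingSolver using (solve-∀)
open import Data.Product using (Σ; ∃; ∃₂; ∃-syntax; _×_; _,_; proj₁; proj₂)
open import Data.Sum using (_⊎_; inj₁; inj₂; [_,_])
open import Data.Vec using (Vec; []; _∷_; _++_)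
import Data.Vec.Functional as Vector
open import Data.Vec.Functional.Properties using (∷-cong)
open import Function using (id; _∘_)
open import Function.Definitions using (Injective)
open import Induction.WellFounded using (Acc; acc)
open import Relation.Binary.PropositionalEquality
  using (_≡_; _≢_; refl; trans; cong; subst; subst₂; _≗_) renaming (sym to ≡-sym)
open import Relation.Nullary using (Dec; yes; no)
open import Relation.Nullary.Decidable using (map′; _×-dec_; _→-dec_; ¬?)

n≤2^⌈log₂n⌉ : ∀ n → n ≤ 2 ^ ⌈log₂ n ⌉
n≤2^⌈log₂n⌉ n = bound n _
  where
  bound : ∀ n (rec : Acc _<_ n) → n ≤ 2 ^ ⌈log2⌉ n rec
  bound 0 _ = z≤n
  bound 1 _ = s≤s z≤n
  bound (suc (suc n)) (acc rs) = ≤-trans 2+n≤2*[1+c] (*-monoʳ-≤ 2 (bound (suc c) _))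
    where
    c = ⌈ n /2⌉
    double : ∀ c → 2 + (c + c) ≡ 2 * suc c
    double = solve-∀
    2+n≤2*[1+c] : 2 + n ≤ 2 * suc c
    2+n≤2*[1+c] = ≤-trans (s≤s (s≤s (≤-trans (≤-reflexive (≡-sym (⌊n/2⌋+⌈n/2⌉≡n n)))
                              (+-monoˡ-≤ c (⌊n/2⌋≤⌈n/2⌉ n)))))
                          (≤-reflexive (double c))

m<2*m : ∀ {m} → 0 < m → m < 2 * m
m<2*m {m} 0<m = subst (m <_) (m+m≡2*m m) (m<m+n m 0<m)
  where
  m+m≡2*m : ∀ m → m + m ≡ 2 * m
  m+m≡2*m = solve-∀

multiple-between : ∀ q p .{{_ : NonZero p}} → ∃[ B ] (q ≤ B * p × B * p ≤ q + p)
multiple-between q p = suc (q / p) , q≤ , ≤q+p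
  where
  q≤ : q ≤ p + q / p * p
  q≤ = ≤-trans (≤-reflexive (m≡m%n+[m/n]*n q p)) (+-monoˡ-≤ (q / p * p) (<⇒≤ (m%n<n q p)))
  ≤q+p : p + q / p * p ≤ q + p
  ≤q+p = ≤-trans (+-monoʳ-≤ p (m/n*n≤m q p)) (≤-reflexive (+-comm p q))

absorb : ∀ {a k b c q} → a + k ≤ b → c ≤ k * q → a * q + c ≤ b * q
absorb {a} {k} {b} {c} {q} a+k≤b c≤kq = begin
  a * q + c     ≤⟨ +-monoʳ-≤ (a * q) c≤kq ⟩
  a * q + k * q ≡⟨ *-distribʳ-+ q a k ⟨
  (a + k) * q   ≤⟨ *-monoˡ-≤ q a+k≤b ⟩
  b * q         ∎
  where open ≤-Reasoning

rounds-bound : ∀ {T L B p q} → T ≤ L * B + L * B → B * p ≤ q + p → p ≤ q → T * p ≤ 4 * q * L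
rounds-bound {T} {L} {B} {p} {q} T≤ Bp≤q+p p≤q = begin
  T * p                 ≤⟨ *-monoˡ-≤ p T≤ ⟩
  (L * B + L * B) * p   ≡⟨ regroup L B p ⟩
  2 * L * (B * p)       ≤⟨ *-monoʳ-≤ (2 * L) (≤-trans Bp≤q+p (+-monoʳ-≤ q p≤q)) ⟩
  2 * L * (q + q)       ≡⟨ regroup′ L q ⟩
  4 * q * L             ∎
  where
  open ≤-Reasoning
  regroup : ∀ L B p → (L * B + L * B) * p ≡ 2 * L * (B * p)
  regroup = solve-∀
  regroup′ : ∀ L q → 2 * L * (q + q) ≡ 4 * q * L
  regroup′ = solve-∀

∣∁p∣+∣p∣≡n : ∀ {n} (p : Subset n) → ∣ ∁ p ∣ + ∣ p ∣ ≡ n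
∣∁p∣+∣p∣≡n p = trans (cong (_+ ∣ p ∣) (∣∁p∣≡n∸∣p∣ p)) (m∸n+n≡m (∣p∣≤n p))

x∈p⇒0<∣p∣ : ∀ {n} {x : Fin n} {p : Subset n} → x ∈ p → 0 < ∣ p ∣
x∈p⇒0<∣p∣ {n} {x} {p} x∈p = subst (_< ∣ p ∣) (∣⊥∣≡0 n) (p⊂q⇒∣p∣<∣q∣ (⊥⊆ , x , x∈p , ∉⊥))

0<∣p∣⇒nonempty : ∀ {n} {p : Subset n} → 0 < ∣ p ∣ → Nonempty p
0<∣p∣⇒nonempty {n} {p} 0<∣p∣ with nonempty? p
... | yes ne = ne
... | no ¬ne = ⊥-elim (<⇒≢ 0<∣p∣ (≡-sym (trans (cong ∣_∣ (Empty-unique ¬ne)) (∣⊥∣≡0 n))))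

∣∁p∣≡0⇒x∈p : ∀ {n} {p : Subset n} {x} → ∣ ∁ p ∣ ≡ 0 → x ∈ p
∣∁p∣≡0⇒x∈p {p = p} {x} ∣∁p∣≡0 with x ∈? p
... | yes x∈p = x∈p
... | no x∉p = ⊥-elim (<⇒≢ (x∈p⇒0<∣p∣ (x∉p⇒x∈∁p x∉p)) (≡-sym ∣∁p∣≡0))

∣p∣+k≤∣q∣⇒∣∁q∣+k≤∣∁p∣ : ∀ {n} {p q : Subset n} {k} → ∣ p ∣ + k ≤ ∣ q ∣ → ∣ ∁ q ∣ + k ≤ ∣ ∁ p ∣
∣p∣+k≤∣q∣⇒∣∁q∣+k≤∣∁p∣ {p = p} {q} {k} ∣p∣+k≤∣q∣ = +-cancelʳ-≤ ∣ p ∣ _ _ (begin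
  ∣ ∁ q ∣ + k + ∣ p ∣   ≡⟨ shuffle (∣ ∁ q ∣) k (∣ p ∣) ⟩
  ∣ ∁ q ∣ + (∣ p ∣ + k) ≤⟨ +-monoʳ-≤ ∣ ∁ q ∣ ∣p∣+k≤∣q∣ ⟩
  ∣ ∁ q ∣ + ∣ q ∣       ≡⟨ trans (∣∁p∣+∣p∣≡n q) (≡-sym (∣∁p∣+∣p∣≡n p)) ⟩
  ∣ ∁ p ∣ + ∣ p ∣       ∎)
  where
  open ≤-Reasoning
  shuffle : ∀ a b c → a + b + c ≡ a + (c + b)
  shuffle = solve-∀

2*∣∁p∣<n : ∀ {n} {p : Subset n} → n < 2 * ∣ p ∣ → 2 * ∣ ∁ p ∣ < n
2*∣∁p∣<n {n} {p} n<2∣p∣ = begin-strict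
  2 * a  ≡⟨ twice a ⟩
  a + a  <⟨ +-monoʳ-< a a<b ⟩
  a + b  ≡⟨ ∣∁p∣+∣p∣≡n p ⟩
  n      ∎
  where
  open ≤-Reasoning
  a = ∣ ∁ p ∣
  b = ∣ p ∣
  twice : ∀ m → 2 * m ≡ m + m
  twice = solve-∀
  a<b : a < b
  a<b = +-cancelʳ-< b a b (subst₂ _<_ (≡-sym (∣∁p∣+∣p∣≡n p)) (twice b) n<2∣p∣)

∪-injection : ∀ {n k} (f : Fin k → Fin n) → Injective _≡_ _≡_ f → (I : Subset n) → (∀ i → f i ∉ I) →
              ∃[ J ] (∣ I ∣ + k ≤ ∣ J ∣ × (∀ {w} → w ∈ J → w ∈ I ⊎ ∃[ i ] f i ≡ w))
∪-injection {k = zero} f inj I out = I , ≤-reflexive (+-identityʳ ∣ I ∣) , inj₁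
∪-injection {k = suc k} f inj I out = extend (∪-injection (f ∘ suc) (suc-injective ∘ inj) I⁺ out⁺)
  where
  I⁺ = I ∪ ⁅ f zero ⁆
  out⁺ : ∀ i → f (suc i) ∉ I⁺
  out⁺ i fi∈I⁺ with x∈p∪q⁻ I _ fi∈I⁺
  ... | inj₁ fi∈I = out (suc i) fi∈I
  ... | inj₂ fi≡f0 with inj (x∈⁅y⁆⇒x≡y _ fi≡f0)
  ... | ()
  ∣I∣<∣I⁺∣ : ∣ I ∣ < ∣ I⁺ ∣
  ∣I∣<∣I⁺∣ = p⊂q⇒∣p∣<∣q∣ (p⊆p∪q _ , f zero , q⊆p∪q I _ (x∈⁅x⁆ _) , out zero)
  extend : ∃[ J ] (∣ I⁺ ∣ + k ≤ ∣ J ∣ × (∀ {w} → w ∈ J → w ∈ I⁺ ⊎ ∃[ i ] f (suc i) ≡ w)) →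
           ∃[ J ] (∣ I ∣ + suc k ≤ ∣ J ∣ × (∀ {w} → w ∈ J → w ∈ I ⊎ ∃[ i ] f i ≡ w))
  extend (J , size , mem) =
    J , ≤-trans (≤-reflexive (+-suc ∣ I ∣ k)) (≤-trans (+-monoˡ-≤ k ∣I∣<∣I⁺∣) size) , mem′
    where
    mem′ : ∀ {w} → w ∈ J → w ∈ I ⊎ ∃[ i ] f i ≡ w
    mem′ w∈J with mem w∈J
    ... | inj₂ (i , fi≡w) = inj₂ (suc i , fi≡w)
    ... | inj₁ w∈I⁺ with x∈p∪q⁻ I _ w∈I⁺
    ...   | inj₁ w∈I = inj₁ w∈I
    ...   | inj₂ w≡f0 = inj₂ (zero , ≡-sym (x∈⁅y⁆⇒x≡y _ w≡f0))

∃-fun? : ∀ {m} k (P : (Fin k → Fin m) → Set) → (∀ {f g} → f ≗ g → P f → P g) →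
         (∀ f → Dec (P f)) → Dec (∃ P)
∃-fun? {m} zero P resp P? = map′ (λ Pf → none , Pf) (λ (f , Pf) → resp (λ ()) Pf) (P? none)
  where
  none : Fin 0 → Fin m
  none ()
∃-fun? (suc k) P resp P? = map′
  (λ (a , f , Pa∷f) → a Vector.∷ f , Pa∷f)
  (λ (f , Pf) → Vector.head f , Vector.tail f , resp (≡-sym ∘ ∷-cong refl (λ _ → refl)) Pf)
  (any? λ a → ∃-fun? k (P ∘ (a Vector.∷_)) (resp ∘ ∷-cong refl) (P? ∘ (a Vector.∷_)))

greatest : {P : ℕ → Set} → (∀ k → Dec (P k)) → P 0 → ∀ N → (∀ {k} → P k → k ≤ N) →
           ∃[ k ] (P k × ∀ j → P j → j ≤ k)
greatest {P} P? P0 N bounded =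
  let (k , Pk , maximal) = below N in k , Pk , λ j Pj → maximal Pj (bounded Pj)
  where
  below : ∀ m → ∃[ k ] (P k × ∀ {j} → P j → j ≤ m → j ≤ k)
  below zero = 0 , P0 , λ _ j≤0 → j≤0
  below (suc m) with P? (suc m)
  ... | yes P[1+m] = suc m , P[1+m] , λ _ j≤1+m → j≤1+m
  ... | no ¬P[1+m] =
    let (k , Pk , maximal) = below m
    in k , Pk , λ Pj j≤1+m → [ (λ j<1+m → maximal Pj (≤-pred j<1+m))
                             , (λ j≡1+m → ⊥-elim (¬P[1+m] (subst P j≡1+m Pj))) ]
                             (m≤n⇒m<n∨m≡n j≤1+m)

partner : ∀ {n k} (f g : Fin k → Fin n) → Fin n → Maybe (Fin n)
partner f g u with any? (λ i → f i ≟ᶠ u)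
... | yes (i , _) = just (g i)
... | no _ = nothing

module _ {n k} {f g : Fin k → Fin n} where

  partner-just : ∀ {u v} → partner f g u ≡ just v → ∃[ i ] (f i ≡ u × g i ≡ v)
  partner-just {u} eq with any? (λ i → f i ≟ᶠ u)
  partner-just refl | yes (i , fi≡u) = i , fi≡u , refl

  partner-nothing : ∀ {u} → (∀ i → f i ≢ u) → partner f g u ≡ nothing
  partner-nothing {u} f≢u with any? (λ i → f i ≟ᶠ u)
  ... | yes (i , fi≡u) = ⊥-elim (f≢u i fi≡u)
  ... | no _ = refl

  partner-image : Injective _≡_ _≡_ f → ∀ i → partner f g (f i) ≡ just (g i)
  partner-image inj i with any? (λ j → f j ≟ᶠ f i)
  ... | yes (j , fj≡fi) = cong (just ∘ g) (inj fj≡fi)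
  ... | no ¬∃ = ⊥-elim (¬∃ (i , refl))

module _ {n : ℕ} {G : Graph n} where

  run-mono : ∀ {T} (rs : Vec (Round G) T) {K K′ : Fin n → Set} →
             (∀ {w} → K w → K′ w) → ∀ {w} → run K rs w → run K′ rs w
  run-mono [] K⊆K′ = K⊆K′
  run-mono (r ∷ rs) K⊆K′ = run-mono rs (step-mono K⊆K′)
    where
    step-mono : ∀ {K K′ : Fin n → Set} → (∀ {w} → K w → K′ w) →
                ∀ {w} → stepInformed r K w → stepInformed r K′ w
    step-mono K⊆K′ (inj₁ Kw) = inj₁ (K⊆K′ Kw)
    step-mono K⊆K′ (inj₂ (inj₁ (u , c , Ku))) = inj₂ (inj₁ (u , c , K⊆K′ Ku))
    step-mono K⊆K′ (inj₂ (inj₂ (v , c , Kv))) = inj₂ (inj₂ (v , c , K⊆K′ Kv))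

  run-++ : ∀ {T T′} (K : Fin n → Set) (rs : Vec (Round G) T) (rs′ : Vec (Round G) T′) →
           run K (rs ++ rs′) ≡ run (run K rs) rs′
  run-++ K [] rs′ = refl
  run-++ K (r ∷ rs) rs′ = run-++ (stepInformed r K) rs rs′

module Spreading {n : ℕ} (G : Graph n) where

  Spreads : Subset n → ℕ → Subset n → Set
  Spreads I b J = ∃[ T ] (T ≤ b × Σ (Vec (Round G) T) λ rs → ∀ {w} → w ∈ J → run (_∈ I) rs w)

  ⊆⇒Spreads : ∀ {I J} → J ⊆ I → Spreads I 0 J
  ⊆⇒Spreads J⊆I = 0 , z≤n , [] , J⊆I

  Spreads-weaken : ∀ {I J b b′} → b ≤ b′ → Spreads I b J → Spreads I b′ J
  Spreads-weaken b≤b′ (T , T≤b , rs , covers) = T , ≤-trans T≤b b≤b′ , rs , covers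

  Spreads-trans : ∀ {I J K a b} → Spreads I a J → Spreads J b K → Spreads I (a + b) K
  Spreads-trans {I} (T , T≤a , rs , coversJ) (T′ , T′≤b , rs′ , coversK) =
    T + T′ , +-mono-≤ T≤a T′≤b , rs ++ rs′ ,
    λ w∈K → subst (λ K → K _) (≡-sym (run-++ (_∈ I) rs rs′)) (run-mono rs′ coversJ (coversK w∈K))

  round⇒Spreads : ∀ {I J} (r : Round G) → (∀ {w} → w ∈ J → stepInformed r (_∈ I) w) → Spreads I 1 J
  round⇒Spreads r covers = 1 , ≤-refl , r ∷ [] , covers

  Spreads-⊤⇒SolvesIn : ∀ {src b} → Spreads ⁅ src ⁆ b ⊤ → ∃[ T ] (T ≤ b × SolvesIn G src T)
  Spreads-⊤⇒SolvesIn {src} (T , T≤b , rs , covers) =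
    T , T≤b , rs , λ w → run-mono rs (x∈⁅y⁆⇒x≡y src) (covers ∈⊤)

  Spreads-iterate : ∀ {Done : Subset n → Set} (Good : ℕ → Subset n → Set) →
    (∀ s J → Good s J → Done J ⊎ ∃[ J′ ] (Spreads J 1 J′ × Good (suc s) J′)) →
    ∀ t {I} → Good 0 I → ∃[ J ] (Spreads I t J × (Done J ⊎ Good t J))
  Spreads-iterate Good advance zero {I} good = I , ⊆⇒Spreads id , inj₂ good
  Spreads-iterate Good advance (suc t) {I} good with advance 0 I good
  ... | inj₁ done = I , Spreads-weaken z≤n (⊆⇒Spreads id) , inj₁ done
  ... | inj₂ (J , spreads , good′) =
    let (K , spreads′ , result) = Spreads-iterate (Good ∘ suc) (advance ∘ suc) t good′
    in K , Spreads-trans spreads spreads′ , result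

  IsMatching : ∀ {k} → Subset n → (left right : Fin k → Fin n) → Set
  IsMatching S left right =
    (∀ i → left i ∈ S) × (∀ i → right i ∉ S) × (∀ i → Adj G (left i) (right i) ≡ true) ×
    (∀ i j → left i ≡ left j → i ≡ j) × (∀ i j → right i ≡ right j → i ≡ j)

  IsMatching-resp : ∀ {k S} {l l′ r r′ : Fin k → Fin n} → l ≗ l′ → r ≗ r′ →
                    IsMatching S l r → IsMatching S l′ r′
  IsMatching-resp {S = S} l≗l′ r≗r′ (lIn , rOut , edge , injL , injR) =
      (λ i → subst (_∈ S) (l≗l′ i) (lIn i))
    , (λ i → subst (_∉ S) (r≗r′ i) (rOut i))
    , (λ i → subst₂ (λ u v → Adj G u v ≡ true) (l≗l′ i) (r≗r′ i) (edge i))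
    , (λ i j eq → injL i j (trans (l≗l′ i) (trans eq (≡-sym (l≗l′ j)))))
    , (λ i j eq → injR i j (trans (r≗r′ i) (trans eq (≡-sym (r≗r′ j)))))

  IsMatching? : ∀ {k} S (l r : Fin k → Fin n) → Dec (IsMatching S l r)
  IsMatching? S l r =
    all? (λ i → l i ∈? S) ×-dec all? (λ i → ¬? (r i ∈? S)) ×-dec
    all? (λ i → Adj G (l i) (r i) Bool.≟ true) ×-dec injective? l ×-dec injective? r
    where
    injective? : ∀ {k} (f : Fin k → Fin n) → Dec (∀ i j → f i ≡ f j → i ≡ j)
    injective? f = all? λ i → all? λ j → (f i ≟ᶠ f j) →-dec (i ≟ᶠ j)

  MatchingB? : ∀ S k → Dec (MatchingB G S k)
  MatchingB? S k = map′ bundle unbundle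
    (∃-fun? k (λ l → ∃ (IsMatching S l)) (λ l≗l′ (r , m) → r , IsMatching-resp l≗l′ (λ _ → refl) m)
      λ l → ∃-fun? k (IsMatching S l) (IsMatching-resp λ _ → refl) (IsMatching? S l))
    where
    bundle : ∃₂ (IsMatching S) → MatchingB G S k
    bundle (l , r , lIn , rOut , edge , injL , injR) = record
      { left = l ; right = r ; leftIn = lIn ; rightOut = rOut ; isEdge = edge
      ; injL = injL _ _ ; injR = injR _ _ }
    unbundle : MatchingB G S k → ∃₂ (IsMatching S)
    unbundle M = left , right , leftIn , rightOut , isEdge , (λ _ _ → injL) , (λ _ _ → injR)
      where open MatchingB M

  ν-exists : ∀ S → ∃ (IsNu G S)
  ν-exists S = greatest (MatchingB? S) empty n (injective⇒≤ ∘ MatchingB.injL)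
    where
    empty : MatchingB G S 0
    empty = record { left = λ () ; right = λ () ; leftIn = λ () ; rightOut = λ () ; isEdge = λ ()
                   ; injL = λ { {()} } ; injR = λ { {()} } }

  MatchingB-size≤ : ∀ {S k} → MatchingB G S k → k ≤ ∣ S ∣
  MatchingB-size≤ {S} {k} M =
    let (J , size , mem) = ∪-injection left injL ⊥ (λ _ → ∉⊥)
    in ≤-trans (subst (λ x → x + k ≤ ∣ J ∣) (∣⊥∣≡0 n) size) (p⊆q⇒∣p∣≤∣q∣ (⊆S mem))
    where
    open MatchingB M
    ⊆S : ∀ {J} → (∀ {w} → w ∈ J → w ∈ ⊥ ⊎ ∃[ i ] left i ≡ w) → J ⊆ S
    ⊆S mem w∈J with mem w∈J
    ... | inj₁ w∈⊥ = ⊥-elim (∉⊥ w∈⊥)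
    ... | inj₂ (i , refl) = leftIn i

  crossing-edge : ∀ (S : Subset n) {x y} → Reach G x y → x ∈ S → y ∉ S →
                  ∃₂ λ u v → u ∈ S × v ∉ S × Adj G u v ≡ true
  crossing-edge S here x∈S y∉S = ⊥-elim (y∉S x∈S)
  crossing-edge S {x} (step {v = v} x~v reach) x∈S y∉S with v ∈? S
  ... | yes v∈S = crossing-edge S reach v∈S y∉S
  ... | no v∉S = x , v , x∈S , v∉S , x~v

  edge-matching : ∀ {S u v} → u ∈ S → v ∉ S → Adj G u v ≡ true → MatchingB G S 1
  edge-matching {u = u} {v} u∈S v∉S u~v = record
    { left = λ _ → u ; right = λ _ → v ; leftIn = λ _ → u∈S ; rightOut = λ _ → v∉S
    ; isEdge = λ _ → u~v ; injL = λ { {zero} {zero} _ → refl } ; injR = λ { {zero} {zero} _ → refl } }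

  module _ {S : Subset n} {k} (M : MatchingB G S k) where
    open MatchingB M

    matchingRound : Round G
    matchingRound = record
      { prop = partner left right
      ; propAdj = λ u v eq → adjacent (partner-just eq)
      ; acc = partner right left
      ; accValid = λ v u eq → valid (partner-just eq) }
      where
      adjacent : ∀ {u v} → ∃[ i ] (left i ≡ u × right i ≡ v) → Adj G u v ≡ true
      adjacent (i , refl , refl) = isEdge i
      valid : ∀ {u v} → ∃[ i ] (right i ≡ v × left i ≡ u) →
              partner left right v ≡ nothing × partner left right u ≡ just v
      valid (i , refl , refl) =
        partner-nothing (λ j lj≡ri → rightOut i (subst (_∈ S) lj≡ri (leftIn j))) , partner-image injL i

    connects : ∀ i → Conn matchingRound (left i) (right i)
    connects i = partner-image injR i

  injection-round : ∀ {I k} (r : Round G) (f : Fin k → Fin n) → Injective _≡_ _≡_ f →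
    (∀ i → f i ∉ I) → (∀ i → stepInformed r (_∈ I) (f i)) → ∃[ J ] (Spreads I 1 J × ∣ I ∣ + k ≤ ∣ J ∣)
  injection-round {I} r f inj out informed with ∪-injection f inj I out
  ... | J , size , mem =
    J , round⇒Spreads r (λ w∈J → [ inj₁ , (λ { (i , refl) → informed i }) ] (mem w∈J)) , size

  matching-informs-right : ∀ {I k} → MatchingB G I k → ∃[ J ] (Spreads I 1 J × ∣ I ∣ + k ≤ ∣ J ∣)
  matching-informs-right M = injection-round (matchingRound M) right injR rightOut
    (λ i → inj₂ (inj₁ (left i , connects M i , leftIn i)))
    where open MatchingB M

  matching-informs-left : ∀ {I k} → MatchingB G (∁ I) k → ∃[ J ] (Spreads I 1 J × ∣ I ∣ + k ≤ ∣ J ∣)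
  matching-informs-left M = injection-round (matchingRound M) left injL (x∈∁p⇒x∉p ∘ leftIn)
    (λ i → inj₂ (inj₂ (right i , connects M i , x∉∁p⇒x∈p (rightOut i))))
    where open MatchingB M

module Rumor {n : ℕ} (G : Graph n) (p q : ℕ) {{_ : NonZero q}}
  (γ-bound : ∀ S → 0 < ∣ S ∣ → 2 * ∣ S ∣ ≤ n → ∀ k → IsNu G S k → p * ∣ S ∣ ≤ k * q)
  (B : ℕ) (q≤Bp : q ≤ B * p) where
  open Spreading G

  expand-round : ∀ I → 0 < ∣ I ∣ → 2 * ∣ I ∣ ≤ n →
                 ∃[ J ] (Spreads I 1 J × ∣ I ∣ * q + p * ∣ I ∣ ≤ ∣ J ∣ * q)
  expand-round I 0<∣I∣ 2∣I∣≤n =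
    let (k , isν) = ν-exists I
        (J , spreads , size) = matching-informs-right (proj₁ isν)
    in J , spreads , absorb {∣ I ∣} {k} {q = q} size (γ-bound I 0<∣I∣ 2∣I∣≤n k isν)

  shrink-round : ∀ I → 0 < ∣ ∁ I ∣ → 2 * ∣ ∁ I ∣ ≤ n →
                 ∃[ J ] (Spreads I 1 J × ∣ ∁ J ∣ * q + p * ∣ ∁ I ∣ ≤ ∣ ∁ I ∣ * q)
  shrink-round I 0<∣∁I∣ 2∣∁I∣≤n =
    let (k , isν) = ν-exists (∁ I)
        (J , spreads , size) = matching-informs-left (proj₁ isν)
    in J , spreads , absorb {∣ ∁ J ∣} {k} {q = q} (∣p∣+k≤∣q∣⇒∣∁q∣+k≤∣∁p∣ {p = I} {J} size)
                                                (γ-bound (∁ I) 0<∣∁I∣ 2∣∁I∣≤n k isν)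

  doubled : ∀ {a b} → a * q + B * p * a ≤ b * q → 2 * a ≤ b
  doubled {a} {b} gained = *-cancelʳ-≤ (2 * a) b q (begin
    2 * a * q         ≡⟨ split a q ⟩
    a * q + q * a     ≤⟨ +-monoʳ-≤ (a * q) (*-monoˡ-≤ a q≤Bp) ⟩
    a * q + B * p * a ≤⟨ gained ⟩
    b * q             ∎)
    where
    open ≤-Reasoning
    split : ∀ a q → 2 * a * q ≡ a * q + q * a
    split = solve-∀

  ≤-from-*q : ∀ {a c b} → a * q + c ≤ b * q → a ≤ b
  ≤-from-*q {a} {c} {b} le = *-cancelʳ-≤ a b q (≤-trans (m≤m+n (a * q) c) le)

  -- After s rounds from m = |I| informed nodes, either more than half are informed or
  -- m (1 + s γ) are.
  doubling : ∀ I → 0 < ∣ I ∣ → ∃[ J ] (Spreads I B J × (n < 2 * ∣ J ∣ ⊎ 2 * ∣ I ∣ ≤ ∣ J ∣))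
  doubling I 0<m = conclude (Spreads-iterate {Done = λ J → n < 2 * ∣ J ∣} Grown grow B
                                              (≤-reflexive (+-identityʳ (m * q))))
    where
    m = ∣ I ∣
    Grown : ℕ → Subset n → Set
    Grown s J = m * q + s * p * m ≤ ∣ J ∣ * q
    grow : ∀ s J → Grown s J → n < 2 * ∣ J ∣ ⊎ ∃[ J′ ] (Spreads J 1 J′ × Grown (suc s) J′)
    grow s J grown with n <? 2 * ∣ J ∣
    ... | yes n<2∣J∣ = inj₁ n<2∣J∣
    ... | no n≮2∣J∣ =
      let m≤∣J∣ = ≤-from-*q {m} grown
          (J′ , spreads , expanded) = expand-round J (<-≤-trans 0<m m≤∣J∣) (≮⇒≥ n≮2∣J∣)
      in inj₂ (J′ , spreads , (begin
        m * q + suc s * p * m         ≡⟨ regroup m q s p ⟩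
        (m * q + s * p * m) + p * m   ≤⟨ +-mono-≤ grown (*-monoʳ-≤ p m≤∣J∣) ⟩
        ∣ J ∣ * q + p * ∣ J ∣         ≤⟨ expanded ⟩
        ∣ J′ ∣ * q                    ∎))
      where
      open ≤-Reasoning
      regroup : ∀ m q s p → m * q + suc s * p * m ≡ (m * q + s * p * m) + p * m
      regroup = solve-∀
    conclude : ∃[ J ] (Spreads I B J × (n < 2 * ∣ J ∣ ⊎ Grown B J)) →
               ∃[ J ] (Spreads I B J × (n < 2 * ∣ J ∣ ⊎ 2 * m ≤ ∣ J ∣))
    conclude (J , spreads , inj₁ majority) = J , spreads , inj₁ majority
    conclude (J , spreads , inj₂ grown) = J , spreads , inj₂ (doubled grown)

  -- After s rounds from m = |∁ I| uninformed nodes, either none or at most m / (1 + s γ) remain.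
  halving : ∀ I → 2 * ∣ ∁ I ∣ ≤ n → ∃[ J ] (Spreads I B J × 2 * ∣ ∁ J ∣ ≤ ∣ ∁ I ∣)
  halving I 2m≤n = conclude (Spreads-iterate {Done = λ J → ∣ ∁ J ∣ ≡ 0} Shrunk shrink B
                                              (≤-reflexive (+-identityʳ (m * q))))
    where
    m = ∣ ∁ I ∣
    Shrunk : ℕ → Subset n → Set
    Shrunk s J = ∣ ∁ J ∣ * q + s * p * ∣ ∁ J ∣ ≤ m * q
    shrink : ∀ s J → Shrunk s J → ∣ ∁ J ∣ ≡ 0 ⊎ ∃[ J′ ] (Spreads J 1 J′ × Shrunk (suc s) J′)
    shrink s J shrunk with ∣ ∁ J ∣ ≟ 0
    ... | yes none = inj₁ none
    ... | no some =
      let 2u≤n = ≤-trans (*-monoʳ-≤ 2 (≤-from-*q {u J} {b = m} shrunk)) 2m≤n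
          (J′ , spreads , shrunk′) = shrink-round J (n≢0⇒n>0 some) 2u≤n
          u′≤u = ≤-from-*q shrunk′
      in inj₂ (J′ , spreads , (begin
        u J′ * q + suc s * p * u J′             ≡⟨ regroup (u J′) q s p ⟩
        (u J′ * q + p * u J′) + s * p * u J′    ≤⟨ +-mono-≤ (+-monoʳ-≤ (u J′ * q) (*-monoʳ-≤ p u′≤u))
                                                             (*-monoʳ-≤ (s * p) u′≤u) ⟩
        (u J′ * q + p * u J) + s * p * u J      ≤⟨ +-monoˡ-≤ (s * p * u J) shrunk′ ⟩
        u J * q + s * p * u J                   ≤⟨ shrunk ⟩
        m * q                                   ∎))
      where
      open ≤-Reasoning
      u : Subset n → ℕ
      u K = ∣ ∁ K ∣
      regroup : ∀ a q s p → a * q + suc s * p * a ≡ (a * q + p * a) + s * p * a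
      regroup = solve-∀
    conclude : ∃[ J ] (Spreads I B J × (∣ ∁ J ∣ ≡ 0 ⊎ Shrunk B J)) →
               ∃[ J ] (Spreads I B J × 2 * ∣ ∁ J ∣ ≤ m)
    conclude (J , spreads , inj₁ none) = J , spreads , subst (λ a → 2 * a ≤ m) (≡-sym none) z≤n
    conclude (J , spreads , inj₂ shrunk) = J , spreads , doubled shrunk

  inform-half : ∀ f I → 0 < ∣ I ∣ → n ≤ 2 ^ f * ∣ I ∣ → ∃[ J ] (Spreads I (f * B) J × n < 2 * ∣ J ∣)
  inform-half zero I 0<∣I∣ n≤∣I∣ =
    I , ⊆⇒Spreads id , ≤-<-trans (≤-trans n≤∣I∣ (≤-reflexive (*-identityˡ ∣ I ∣))) (m<2*m 0<∣I∣)
  inform-half (suc f) I 0<∣I∣ n≤ with doubling I 0<∣I∣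
  ... | J , spreads , inj₁ n<2∣J∣ = J , Spreads-weaken (m≤m+n B (f * B)) spreads , n<2∣J∣
  ... | J , spreads , inj₂ 2∣I∣≤∣J∣ =
    let (K , spreads′ , n<2∣K∣) = inform-half f J 0<∣J∣ n≤2^f*∣J∣
    in K , Spreads-trans spreads spreads′ , n<2∣K∣
    where
    0<∣J∣ : 0 < ∣ J ∣
    0<∣J∣ = <-≤-trans 0<∣I∣ (≤-trans (m≤m+n ∣ I ∣ _) 2∣I∣≤∣J∣)
    regroup : ∀ x m → 2 * x * m ≡ x * (2 * m)
    regroup = solve-∀
    n≤2^f*∣J∣ : n ≤ 2 ^ f * ∣ J ∣
    n≤2^f*∣J∣ = ≤-trans n≤ (≤-trans (≤-reflexive (regroup (2 ^ f) ∣ I ∣)) (*-monoʳ-≤ (2 ^ f) 2∣I∣≤∣J∣))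

  inform-all : ∀ f I → 2 * ∣ ∁ I ∣ ≤ n → ∣ ∁ I ∣ < 2 ^ f → Spreads I (f * B) ⊤
  inform-all zero I _ ∣∁I∣<1 = ⊆⇒Spreads (λ _ → ∣∁p∣≡0⇒x∈p (n<1⇒n≡0 ∣∁I∣<1))
  inform-all (suc f) I 2∣∁I∣≤n ∣∁I∣<2^[1+f] =
    let (J , spreads , 2∣∁J∣≤∣∁I∣) = halving I 2∣∁I∣≤n
    in Spreads-trans spreads (inform-all f J
         (≤-trans 2∣∁J∣≤∣∁I∣ (≤-trans (m≤m+n ∣ ∁ I ∣ _) 2∣∁I∣≤n))
         (*-cancelˡ-< 2 _ _ (≤-<-trans 2∣∁J∣≤∣∁I∣ ∣∁I∣<2^[1+f])))

  inform-everyone : ∀ L → n ≤ 2 ^ L → ∀ src → Spreads ⁅ src ⁆ (L * B + L * B) ⊤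
  inform-everyone L n≤2^L src =
    let (J , spreads , n<2∣J∣) = inform-half L ⁅ src ⁆ 0<∣⁅src⁆∣ n≤2^L*∣⁅src⁆∣
        2∣∁J∣<n = 2*∣∁p∣<n {p = J} n<2∣J∣
    in Spreads-trans spreads (inform-all L J (<⇒≤ 2∣∁J∣<n)
         (<-≤-trans (≤-<-trans (m≤m+n (∣ ∁ J ∣) _) 2∣∁J∣<n) n≤2^L))
    where
    0<∣⁅src⁆∣ : 0 < ∣ ⁅ src ⁆ ∣
    0<∣⁅src⁆∣ = x∈p⇒0<∣p∣ (x∈⁅x⁆ src)
    n≤2^L*∣⁅src⁆∣ : n ≤ 2 ^ L * ∣ ⁅ src ⁆ ∣
    n≤2^L*∣⁅src⁆∣ = subst (n ≤_) (≡-sym (trans (cong (2 ^ L *_) (∣⁅x⁆∣≡1 src)) (*-identityʳ _))) n≤2^L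

-- 0 < γ ≤ 1: some edge leaves a nonempty S of at most half the nodes, and ν(B(S)) ≤ |S|.
γ-bounds : ∀ {n} {G : Graph n} {p q} → Connected G → IsGamma G p q → 0 < p × p ≤ q
γ-bounds {n} {G} {p} {q} connected (nz , (S , 0<∣S∣ , 2∣S∣≤n , k , (M , maximal) , kq≡p∣S∣) , _) =
  0<p , p≤q
  where
  instance _ = nz
  open Spreading G
  0<∣∁S∣ : 0 < ∣ ∁ S ∣
  0<∣∁S∣ = +-cancelʳ-< (∣ S ∣) 0 (∣ ∁ S ∣)
    (subst (∣ S ∣ <_) (≡-sym (∣∁p∣+∣p∣≡n S)) (<-≤-trans (m<2*m 0<∣S∣) 2∣S∣≤n))
  1≤k : 1 ≤ k
  1≤k = let (x , x∈S) = 0<∣p∣⇒nonempty 0<∣S∣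
            (y , y∈∁S) = 0<∣p∣⇒nonempty 0<∣∁S∣
            (u , v , u∈S , v∉S , u~v) = crossing-edge S (connected x y) x∈S (x∈∁p⇒x∉p y∈∁S)
        in maximal 1 (edge-matching u∈S v∉S u~v)
  0<p : 0 < p
  0<p = n≢0⇒n>0 λ p≡0 →
    <⇒≢ (*-mono-≤ 1≤k (>-nonZero⁻¹ q)) (≡-sym (trans kq≡p∣S∣ (cong (_* ∣ S ∣) p≡0)))
  p≤q : p ≤ q
  p≤q = *-cancelʳ-≤ p q (∣ S ∣) {{>-nonZero 0<∣S∣}}
    (≤-trans (≤-reflexive (≡-sym kq≡p∣S∣))
      (≤-trans (*-monoˡ-≤ q (MatchingB-size≤ M)) (≤-reflexive (*-comm ∣ S ∣ q))))

lemma2 : ∃[ c ] (∀ {n} (G : Graph n) → Connected G → (src : Fin n)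
           → (p q : ℕ) → IsGamma G p q
           → ∃[ T ] (SolvesIn G src T × T * p ≤ c * q * ⌈log₂ n ⌉))
lemma2 = 4 , λ {n} G connected src p q γ →
  let instance _ = proj₁ γ
      (0<p , p≤q) = γ-bounds connected γ
      (B , q≤Bp , Bp≤q+p) = multiple-between q p {{>-nonZero 0<p}}
      L = ⌈log₂ n ⌉
      spreads = Rumor.inform-everyone G p q (proj₂ (proj₂ γ)) B q≤Bp L (n≤2^⌈log₂n⌉ n) src
      (T , T≤ , solves) = Spreading.Spreads-⊤⇒SolvesIn G spreads
  in T , solves , rounds-bound T≤ Bp≤q+p p≤q
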